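{- For every $n$ with $4 \leq n \leq 10$, $ext(n,\{K_{1,3}+e, C_4\}) = ext(n,\{C_3,C_4\})$.
   Context: For a family $\mathcal{H}$ of graphs, $ext(n,\mathcal{H})$ is the maximum number of edges in a graph on $n$ vertices containing no member of $\mathcal{H}$ as a subgraph. $C_k$ denotes the cycle on $k$ vertices, and $K_{1,3}+e$ denotes the star $K_{1,3}$ with one edge added between two of its leaves (a triangle with a pendant edge). -}

module Defs where

open import Data.Nat using (ℕ; zero; suc; _≡ᵇ_; _<ᵇ_; _≤_)
open import Data.Bool using (Bool; true; false; _∧_; _∨_; if_then_else_)
open import Data.Fin using (Fin; toℕ)
open import Data.List using (List; []; _∷_; map; filter; allFin; cartesianProduct)
open import Data.Nat.ListAction using (sum)
open import Data.Bool.ListAction using (any)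
open import Data.List.Relation.Unary.All using (All)
open import Data.Product using (Σ; ∃; _×_; _,_; proj₁; proj₂)
open import Function.Definitions using (Injective)
open import Relation.Binary.PropositionalEquality using (_≡_)
open import Relation.Nullary using (¬_)
open import Data.Bool using (T)

record Graph (n : ℕ) : Set where
  field
    adj    : Fin n → Fin n → Bool
    sym    : ∀ i j → adj i j ≡ adj j i
    irrefl : ∀ i → adj i i ≡ false
open Graph public

edgeCount : ∀ {n} → Graph n → ℕ
edgeCount {n} G =
  sum (map (λ p → if adj G (proj₁ p) (proj₂ p) then 1 else 0)
           (filter (λ p → T? (toℕ (proj₁ p) <ᵇ toℕ (proj₂ p)))
                   (cartesianProduct (allFin n) (allFin n))))
  where
  open import Data.Bool.Properties using () renaming (T? to T?)

fromEdges : (k : ℕ) → List (ℕ × ℕ) → Fin k → Fin k → Bool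
fromEdges k es i j =
  any (λ e → ((proj₁ e ≡ᵇ toℕ i) ∧ (proj₂ e ≡ᵇ toℕ j))
           ∨ ((proj₁ e ≡ᵇ toℕ j) ∧ (proj₂ e ≡ᵇ toℕ i))) es

-- G contains H (on k vertices) as a (not necessarily induced) subgraph:
-- an injective vertex map sending edges of H to edges of G.
Contains : ∀ {n} → Graph n → (k : ℕ) → (Fin k → Fin k → Bool) → Set
Contains {n} G k h =
  Σ (Fin k → Fin n) λ f → Injective _≡_ _≡_ f ×
    (∀ i j → h i j ≡ true → adj G (f i) (f j) ≡ true)

Family : Set
Family = List (Σ ℕ λ k → Fin k → Fin k → Bool)

Free : ∀ {n} → Family → Graph n → Set
Free ℋ G = All (λ H → ¬ Contains G (proj₁ H) (proj₂ H)) ℋ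

IsExt : Family → ℕ → ℕ → Set
IsExt ℋ n m =
  (Σ (Graph n) λ G → Free ℋ G × edgeCount G ≡ m) ×
  (∀ (G : Graph n) → Free ℋ G → edgeCount G ≤ m)

C₃ : Σ ℕ λ k → Fin k → Fin k → Bool
C₃ = 3 , fromEdges 3 ((0 , 1) ∷ (1 , 2) ∷ (2 , 0) ∷ [])

C₄ : Σ ℕ λ k → Fin k → Fin k → Bool
C₄ = 4 , fromEdges 4 ((0 , 1) ∷ (1 , 2) ∷ (2 , 3) ∷ (3 , 0) ∷ [])

-- K_{1,3}+e: centre 0, leaves 1,2,3, extra edge 1-2 (triangle with pendant edge)
K₁₃+e : Σ ℕ λ k → Fin k → Fin k → Bool
K₁₃+e = 4 , fromEdges 4 ((0 , 1) ∷ (0 , 2) ∷ (0 , 3) ∷ (1 , 2) ∷ [])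

-- A {K₁₃+e, C₄}-free graph is C₄-free and each of its triangles is a whole connected
-- component, since a third neighbour of a triangle vertex yields K₁₃+e. Such a triangle
-- abc can be destroyed without changing the number of edges and without creating a C₄ or
-- a new triangle: for a vertex w off abc (it exists as n ≥ 4), replace the edge ac by aw;
-- if w lies on a triangle wef, replace wf by fc as well, merging both triangles into the
-- hexagon a b c f e w. Repeating this yields a {C₃, C₄}-free graph with as many edges, and
-- conversely every {C₃, C₄}-free graph is {K₁₃+e, C₄}-free.
module Submission where

open import Defs hiding (sym)
open import Data.Nat using (ℕ; _≤_)
open import Data.List using ([]; _∷_)
open import Function.Bundles using (_⇔_)

open import Data.Bool using (Bool; true; false; _∧_; if_then_else_; T)
open import Data.Bool.Properties using (T-≡; T-∨; T-∧; T?; ¬-not) renaming (_≟_ to _≟ᴮ_)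
open import Data.Empty using (⊥-elim)
open import Data.Fin using (Fin; zero; suc; toℕ; fromℕ<)
open import Data.Fin.Properties
  using (any?; all?; fromℕ<-toℕ; toℕ-fromℕ<; toℕ<n; pigeonhole; ¬∀⟶∃¬; <-irrefl)
  renaming (_≟_ to _≟ᶠ_)
open import Data.List using (List; length; map; filter; allFin; cartesianProduct)
open import Data.List.Membership.Propositional using (_∈_; _∉_)
open import Data.List.Membership.Propositional.Properties using (∈-allFin)
open import Data.List.Membership.Setoid.Properties using (index-injective)
open import Data.List.Properties using (map-cong)
open import Data.List.Relation.Unary.All using (All; []; _∷_)
open import Data.List.Relation.Unary.Any using (here; there; index)
open import Data.Nat using (_<_; _≡ᵇ_; _<ᵇ_; _+_; _*_; s≤s)
open import Data.Nat.ListAction using (sum)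
open import Data.Nat.Properties
  using (≡ᵇ⇒≡; +-identityʳ; +-comm; *-distribʳ-+; +-commutativeSemigroup)
  renaming (_≟_ to _≟ℕ_)
open import Algebra.Properties.CommutativeSemigroup +-commutativeSemigroup using (interchange)
open import Data.Product using (∃; ∃₂; ∃-syntax; Σ-syntax; _×_; _,_; proj₁; proj₂)
open import Data.Sum using (_⊎_; inj₁; inj₂; [_,_]′; swap)
open import Data.Unit using (tt)
open import Data.Vec using (Vec; lookup; []; _∷_)
open import Data.Vec.Relation.Unary.All using ([]; _∷_)
open import Data.Vec.Relation.Unary.AllPairs using ([]; _∷_)
open import Data.Vec.Relation.Unary.Unique.Propositional using (Unique)
open import Data.Vec.Relation.Unary.Unique.Propositional.Properties using (lookup-injective)
open import Function.Base using (case_of_; _∘_)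
open import Function.Bundles using (Equivalence; mk⇔)
open import Relation.Binary.PropositionalEquality
  using (_≡_; _≢_; refl; sym; trans; cong; cong₂; subst; subst₂; setoid; module ≡-Reasoning)
open import Relation.Nullary using (¬_; Dec; yes; no; does)
open import Relation.Nullary.Decidable
  using (_×-dec_; _⊎-dec_; _→-dec_; ¬?; toWitness; does-⇔; dec-true; dec-false)

module _ {n : ℕ} (G : Graph n) where

  Adj : Fin n → Fin n → Set
  Adj i j = adj G i j ≡ true

  Adj? : ∀ i j → Dec (Adj i j)
  Adj? i j = adj G i j ≟ᴮ true

  Adj-sym : ∀ {i j} → Adj i j → Adj j i
  Adj-sym {i} {j} = trans (Graph.sym G j i)

  Adj⇒≢ : ∀ {i j} → Adj i j → i ≢ j
  Adj⇒≢ {i} ii refl = case trans (sym ii) (irrefl G i) of λ ()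

  Triangle : Fin n → Fin n → Fin n → Set
  Triangle x y z = Adj x y × Adj y z × Adj x z

  OnTriangle : Fin n → Set
  OnTriangle x = ∃₂ (Triangle x)

  OnTriangle? : ∀ x → Dec (OnTriangle x)
  OnTriangle? x = any? λ y → any? λ z → Adj? x y ×-dec Adj? y z ×-dec Adj? x z

  TriangleFree : Set
  TriangleFree = ∀ v → ¬ OnTriangle v

  record Square (x y z t : Fin n) : Set where
    field
      xy : Adj x y
      yz : Adj y z
      zt : Adj z t
      tx : Adj t x
      x≢z : x ≢ z
      y≢t : y ≢ t

  SquareFree : Set
  SquareFree = ∀ {x y z t} → ¬ Square x y z t

  TrianglesIsolated : Set
  TrianglesIsolated = ∀ {x y z t} → Triangle x y z → Adj x t → t ≡ y ⊎ t ≡ z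

  Admissible : Set
  Admissible = SquareFree × TrianglesIsolated

  Triangle-rotate : ∀ {x y z} → Triangle x y z → Triangle y z x
  Triangle-rotate (xy , yz , xz) = yz , Adj-sym xz , Adj-sym xy

  Triangle-swap : ∀ {x y z} → Triangle x y z → Triangle x z y
  Triangle-swap (xy , yz , xz) = xz , Adj-sym yz , xy

  Square-rotate : ∀ {x y z t} → Square x y z t → Square y z t x
  Square-rotate s = record
    { xy = yz ; yz = zt ; zt = tx ; tx = xy ; x≢z = y≢t ; y≢t = x≢z ∘ sym }
    where open Square s

  Square-reverse : ∀ {x y z t} → Square x y z t → Square y x t z
  Square-reverse s = record
    { xy = Adj-sym xy ; yz = Adj-sym tx ; zt = Adj-sym zt ; tx = Adj-sym yz
    ; x≢z = y≢t ; y≢t = x≢z }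
    where open Square s

  OnTriangle⇒≢ : ∀ {i v} → ¬ OnTriangle v → OnTriangle i → i ≢ v
  OnTriangle⇒≢ v-off i-on refl = v-off i-on

  isolated-apart : TrianglesIsolated → ∀ {a b c t s} → Triangle a b c → Adj t s →
    t ≢ b → t ≢ c → s ≢ a
  isolated-apart isolated abc ts t≢b t≢c refl = [ t≢b , t≢c ]′ (isolated abc (Adj-sym ts))

  off-triangle-of-two-neighbours : ∀ {x p q} → (∀ {t} → Adj x t → t ≡ p ⊎ t ≡ q) →
    ¬ Adj p q → ¬ OnTriangle x
  off-triangle-of-two-neighbours nbrs p≁q (y , z , xy , yz , xz) with nbrs xy | nbrs xz
  ... | inj₁ refl | inj₁ refl = Adj⇒≢ yz refl
  ... | inj₁ refl | inj₂ refl = p≁q yz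
  ... | inj₂ refl | inj₁ refl = p≁q (Adj-sym yz)
  ... | inj₂ refl | inj₂ refl = Adj⇒≢ yz refl

-- Embeddings of the pattern graphs

module _ {n : ℕ} (G : Graph n) {k : ℕ} (f : Fin k → Fin n) where

  -- Quantifying over the proofs of p < k lets fromℕ< compute on numerals p.
  MapsEdge : ℕ × ℕ → Set
  MapsEdge (p , q) = (p<k : p < k) (q<k : q < k) → Adj G (f (fromℕ< p<k)) (f (fromℕ< q<k))

  maps-edge : ∀ {p q} → MapsEdge (p , q) → ∀ i j → T ((p ≡ᵇ toℕ i) ∧ (q ≡ᵇ toℕ j)) →
    Adj G (f i) (f j)
  maps-edge {p} {q} fe i j ij with Equivalence.to T-∧ ij
  ... | pi , qj with ≡ᵇ⇒≡ p (toℕ i) pi | ≡ᵇ⇒≡ q (toℕ j) qj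
  ... | refl | refl = subst₂ (λ i j → Adj G (f i) (f j))
    (fromℕ<-toℕ i (toℕ<n i)) (fromℕ<-toℕ j (toℕ<n j)) (fe (toℕ<n i) (toℕ<n j))

  maps-fromEdges : ∀ {es} → All MapsEdge es → ∀ i j → fromEdges k es i j ≡ true → Adj G (f i) (f j)
  maps-fromEdges (fe ∷ fes) i j e with Equivalence.to T-∨ (Equivalence.from T-≡ e)
  ... | inj₂ later = maps-fromEdges fes i j (Equivalence.to T-≡ later)
  ... | inj₁ now with Equivalence.to T-∨ now
  ...   | inj₁ ij = maps-edge fe i j ij
  ...   | inj₂ ji = Adj-sym G (maps-edge fe j i ji)

module _ {n : ℕ} (G : Graph n) where

  triangle⇒C₃ : ∀ {x y z} → Triangle G x y z → Contains G 3 (proj₂ C₃)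
  triangle⇒C₃ {x} {y} {z} (xy , yz , xz) =
    lookup vs , (λ {i} {j} → lookup-injective distinct i j) ,
    maps-fromEdges G (lookup vs) {(0 , 1) ∷ (1 , 2) ∷ (2 , 0) ∷ []}
      ((λ _ _ → xy) ∷ (λ _ _ → yz) ∷ (λ _ _ → Adj-sym G xz) ∷ [])
    where
    vs : Vec (Fin n) 3
    vs = x ∷ y ∷ z ∷ []
    distinct : Unique vs
    distinct = (Adj⇒≢ G xy ∷ Adj⇒≢ G xz ∷ []) ∷ (Adj⇒≢ G yz ∷ []) ∷ [] ∷ []

  square⇒C₄ : ∀ {x y z t} → Square G x y z t → Contains G 4 (proj₂ C₄)
  square⇒C₄ {x} {y} {z} {t} s =
    lookup vs , (λ {i} {j} → lookup-injective distinct i j) ,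
    maps-fromEdges G (lookup vs) {(0 , 1) ∷ (1 , 2) ∷ (2 , 3) ∷ (3 , 0) ∷ []}
      ((λ _ _ → xy) ∷ (λ _ _ → yz) ∷ (λ _ _ → zt) ∷ (λ _ _ → tx) ∷ [])
    where
    open Square s
    vs : Vec (Fin n) 4
    vs = x ∷ y ∷ z ∷ t ∷ []
    distinct : Unique vs
    distinct = (Adj⇒≢ G xy ∷ x≢z ∷ Adj⇒≢ G tx ∘ sym ∷ [])
             ∷ (Adj⇒≢ G yz ∷ y≢t ∷ []) ∷ (Adj⇒≢ G zt ∷ []) ∷ [] ∷ []

  pendant-triangle⇒K₁₃+e : ∀ {x y z t} → Triangle G x y z → Adj G x t → t ≢ y → t ≢ z →
    Contains G 4 (proj₂ K₁₃+e)
  pendant-triangle⇒K₁₃+e {x} {y} {z} {t} (xy , yz , xz) xt t≢y t≢z =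
    lookup vs , (λ {i} {j} → lookup-injective distinct i j) ,
    maps-fromEdges G (lookup vs) {(0 , 1) ∷ (0 , 2) ∷ (0 , 3) ∷ (1 , 2) ∷ []}
      ((λ _ _ → xy) ∷ (λ _ _ → xz) ∷ (λ _ _ → xt) ∷ (λ _ _ → yz) ∷ [])
    where
    vs : Vec (Fin n) 4
    vs = x ∷ y ∷ z ∷ t ∷ []
    distinct : Unique vs
    distinct = (Adj⇒≢ G xy ∷ Adj⇒≢ G xz ∷ Adj⇒≢ G xt ∷ [])
             ∷ (Adj⇒≢ G yz ∷ t≢y ∘ sym ∷ []) ∷ (t≢z ∘ sym ∷ []) ∷ [] ∷ []

  embedded-triangle : ∀ {k h} (i j l : Fin k) → h i j ≡ true → h j l ≡ true → h i l ≡ true →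
    Contains G k h → ∃ (OnTriangle G)
  embedded-triangle i j l ij jl il (f , _ , edge) =
    f i , f j , f l , edge i j ij , edge j l jl , edge i l il

  C₄⇒square : Contains G 4 (proj₂ C₄) → ∃[ x ] ∃[ y ] ∃[ z ] ∃[ t ] Square G x y z t
  C₄⇒square (f , f-injective , edge) = _ , _ , _ , _ , record
    { xy = edge zero (suc zero) refl
    ; yz = edge (suc zero) (suc (suc zero)) refl
    ; zt = edge (suc (suc zero)) (suc (suc (suc zero))) refl
    ; tx = edge (suc (suc (suc zero))) zero refl
    ; x≢z = λ e → case f-injective e of λ ()
    ; y≢t = λ e → case f-injective e of λ ()
    }

  C₃C₄-free⇒K₁₃+eC₄-free : Free (C₃ ∷ C₄ ∷ []) G → Free (K₁₃+e ∷ C₄ ∷ []) G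
  C₃C₄-free⇒K₁₃+eC₄-free (no-C₃ ∷ no-C₄ ∷ []) =
    (λ K → let (_ , _ , _ , xyz) = embedded-triangle zero (suc zero) (suc (suc zero))
                                      refl refl refl K
           in no-C₃ (triangle⇒C₃ xyz)) ∷ no-C₄ ∷ []

  K₁₃+eC₄-free⇒admissible : Free (K₁₃+e ∷ C₄ ∷ []) G → Admissible G
  K₁₃+eC₄-free⇒admissible (no-K ∷ no-C₄ ∷ []) = (λ s → no-C₄ (square⇒C₄ s)) , isolated
    where
    isolated : TrianglesIsolated G
    isolated {y = y} {z} {t} xyz xt with t ≟ᶠ y | t ≟ᶠ z
    ... | yes t≡y | _ = inj₁ t≡y
    ... | no _ | yes t≡z = inj₂ t≡z
    ... | no t≢y | no t≢z = ⊥-elim (no-K (pendant-triangle⇒K₁₃+e xyz xt t≢y t≢z))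

  triangle-free⇒C₃C₄-free : SquareFree G → TriangleFree G → Free (C₃ ∷ C₄ ∷ []) G
  triangle-free⇒C₃C₄-free square-free triangle-free =
    (λ H → let (v , on) = embedded-triangle zero (suc zero) (suc (suc zero)) refl refl refl H
           in triangle-free v on) ∷
    (λ H → let (_ , _ , _ , _ , s) = C₄⇒square H in square-free s) ∷ []

-- Changing one adjacency, and counting edges

module _ {n : ℕ} where

  IsPair : Fin n → Fin n → Fin n → Fin n → Set
  IsPair u v i j = (i ≡ u × j ≡ v) ⊎ (i ≡ v × j ≡ u)

  IsPair? : ∀ u v i j → Dec (IsPair u v i j)
  IsPair? u v i j = ((i ≟ᶠ u) ×-dec (j ≟ᶠ v)) ⊎-dec ((i ≟ᶠ v) ×-dec (j ≟ᶠ u))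

  IsPair-swap : ∀ {u v i j} → IsPair u v i j → IsPair u v j i
  IsPair-swap (inj₁ (i≡u , j≡v)) = inj₂ (j≡v , i≡u)
  IsPair-swap (inj₂ (i≡v , j≡u)) = inj₁ (j≡u , i≡v)

  opaque
    setAdj : Graph n → (u v : Fin n) → u ≢ v → Bool → Graph n
    setAdj G u v u≢v b = record { adj = adj′ ; sym = sym′ ; irrefl = irrefl′ }
      where
      adj′ : Fin n → Fin n → Bool
      adj′ i j = if does (IsPair? u v i j) then b else adj G i j

      sym′ : ∀ i j → adj′ i j ≡ adj′ j i
      sym′ i j = cong₂ (λ c d → if c then b else d)
        (does-⇔ (mk⇔ IsPair-swap IsPair-swap) (IsPair? u v i j) (IsPair? u v j i)) (Graph.sym G i j)

      irrefl′ : ∀ i → adj′ i i ≡ false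
      irrefl′ i =
        trans (cong (λ c → if c then b else adj G i i) (dec-false (IsPair? u v i i) diagonal))
              (irrefl G i)
        where
        diagonal : ¬ IsPair u v i i
        diagonal (inj₁ (refl , refl)) = u≢v refl
        diagonal (inj₂ (refl , refl)) = u≢v refl

  removeEdge addEdge : Graph n → (u v : Fin n) → u ≢ v → Graph n
  removeEdge G u v u≢v = setAdj G u v u≢v false
  addEdge    G u v u≢v = setAdj G u v u≢v true

  module _ {G : Graph n} {u v : Fin n} {u≢v : u ≢ v} {i j : Fin n} where

    opaque
      unfolding setAdj

      setAdj-on-pair : ∀ {b} → IsPair u v i j → adj (setAdj G u v u≢v b) i j ≡ b
      setAdj-on-pair {b} p =
        cong (λ c → if c then b else adj G i j) (dec-true (IsPair? u v i j) p)

      setAdj-off-pair : ∀ {b} → ¬ IsPair u v i j → adj (setAdj G u v u≢v b) i j ≡ adj G i j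
      setAdj-off-pair {b} ¬p =
        cong (λ c → if c then b else adj G i j) (dec-false (IsPair? u v i j) ¬p)

    Adj-removeEdge : Adj (removeEdge G u v u≢v) i j → ¬ IsPair u v i j × Adj G i j
    Adj-removeEdge ij with IsPair? u v i j
    ... | yes p  = case trans (sym (setAdj-on-pair p)) ij of λ ()
    ... | no ¬p = ¬p , trans (sym (setAdj-off-pair ¬p)) ij

    Adj-addEdge : Adj (addEdge G u v u≢v) i j → IsPair u v i j ⊎ Adj G i j
    Adj-addEdge ij with IsPair? u v i j
    ... | yes p = inj₁ p
    ... | no ¬p = inj₂ (trans (sym (setAdj-off-pair ¬p)) ij)

χ : Bool → ℕ
χ b = if b then 1 else 0

pairs : (n : ℕ) → List (Fin n × Fin n)
pairs n = filter (λ p → T? (toℕ (proj₁ p) <ᵇ toℕ (proj₂ p)))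
                 (cartesianProduct (allFin n) (allFin n))

pair-multiplicity : ∀ {n} → Fin n → Fin n → ℕ
pair-multiplicity {n} u v = sum (map (λ p → χ (does (IsPair? u v (proj₁ p) (proj₂ p)))) (pairs n))

PairsListedOnce : ℕ → Set
PairsListedOnce n = ∀ (u v : Fin n) → u ≢ v → pair-multiplicity u v ≡ 1

-- True for every n; checked by evaluation in the range the theorem needs.
pairsListedOnce : ∀ {n} → n ≤ 10 → PairsListedOnce n
pairsListedOnce n≤10 = subst PairsListedOnce (toℕ-fromℕ< (s≤s n≤10)) (checked (fromℕ< (s≤s n≤10)))
  where
  PairsListedOnce? : ∀ n → Dec (PairsListedOnce n)
  PairsListedOnce? n = all? λ u → all? λ v → ¬? (u ≟ᶠ v) →-dec (pair-multiplicity u v ≟ℕ 1)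

  checked : ∀ (k : Fin 11) → PairsListedOnce (toℕ k)
  checked = toWitness {a? = all? λ k → PairsListedOnce? (toℕ k)} tt

sum-map-+ : ∀ {A : Set} (f g : A → ℕ) xs →
  sum (map (λ x → f x + g x) xs) ≡ sum (map f xs) + sum (map g xs)
sum-map-+ f g []       = refl
sum-map-+ f g (x ∷ xs) =
  trans (cong (f x + g x +_) (sum-map-+ f g xs)) (interchange (f x) (g x) _ _)

sum-map-*ʳ : ∀ {A : Set} (f : A → ℕ) c xs → sum (map (λ x → f x * c) xs) ≡ sum (map f xs) * c
sum-map-*ʳ f c []       = refl
sum-map-*ʳ f c (x ∷ xs) =
  trans (cong (f x * c +_) (sum-map-*ʳ f c xs)) (sym (*-distribʳ-+ c (f x) _))

χ-if : ∀ c b {x y} → (c ≡ true → x ≡ y) → χ (if c then b else x) + χ c * χ y ≡ χ x + χ c * χ b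
χ-if false b h = refl
χ-if true  b h rewrite h refl = trans (cong (χ b +_) (+-identityʳ _))
  (trans (+-comm (χ b) _) (cong (_ +_) (sym (+-identityʳ (χ b)))))

does-true : ∀ {P : Set} (P? : Dec P) → does P? ≡ true → P
does-true (yes p) _ = p

module _ {n : ℕ} (once : PairsListedOnce n) {G : Graph n} {u v : Fin n} {u≢v : u ≢ v} where

  opaque
    unfolding setAdj

    edgeCount-setAdj : ∀ b → edgeCount (setAdj G u v u≢v b) + χ (adj G u v) ≡ edgeCount G + χ b
    edgeCount-setAdj b = begin
      edgeCount G′ + χ a
        ≡⟨ cong (edgeCount G′ +_) (spread-once (χ a)) ⟨
      edgeCount G′ + spread (χ a)
        ≡⟨ sum-map-+ (λ p → χ (adj G′ (proj₁ p) (proj₂ p))) (λ p → weight p * χ a) (pairs n) ⟨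
      sum (map (λ p → χ (adj G′ (proj₁ p) (proj₂ p)) + weight p * χ a) (pairs n))
        ≡⟨ cong sum (map-cong pointwise (pairs n)) ⟩
      sum (map (λ p → χ (adj G (proj₁ p) (proj₂ p)) + weight p * χ b) (pairs n))
        ≡⟨ sum-map-+ (λ p → χ (adj G (proj₁ p) (proj₂ p))) (λ p → weight p * χ b) (pairs n) ⟩
      edgeCount G + spread (χ b)
        ≡⟨ cong (edgeCount G +_) (spread-once (χ b)) ⟩
      edgeCount G + χ b ∎
      where
      open ≡-Reasoning
      G′ : Graph n
      G′ = setAdj G u v u≢v b
      a : Bool
      a = adj G u v

      weight : Fin n × Fin n → ℕ
      weight p = χ (does (IsPair? u v (proj₁ p) (proj₂ p)))

      spread : ℕ → ℕ
      spread c = sum (map (λ p → weight p * c) (pairs n))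

      spread-once : ∀ c → spread c ≡ c
      spread-once c = trans (sum-map-*ʳ weight c (pairs n))
                            (trans (cong (_* c) (once u v u≢v)) (+-identityʳ c))

      adj-at-pair : ∀ {i j} → IsPair u v i j → adj G i j ≡ a
      adj-at-pair (inj₁ (refl , refl)) = refl
      adj-at-pair (inj₂ (refl , refl)) = Graph.sym G v u

      pointwise : ∀ p → χ (adj G′ (proj₁ p) (proj₂ p)) + weight p * χ a
                      ≡ χ (adj G (proj₁ p) (proj₂ p)) + weight p * χ b
      pointwise (i , j) =
        χ-if (does (IsPair? u v i j)) b (λ e → adj-at-pair (does-true (IsPair? u v i j) e))

  edgeCount-removeEdge : Adj G u v → edgeCount (removeEdge G u v u≢v) + 1 ≡ edgeCount G
  edgeCount-removeEdge uv = trans (cong (λ c → edgeCount (removeEdge G u v u≢v) + χ c) (sym uv))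
                                  (trans (edgeCount-setAdj false) (+-identityʳ _))

  edgeCount-addEdge : ¬ Adj G u v → edgeCount (addEdge G u v u≢v) ≡ edgeCount G + 1
  edgeCount-addEdge ¬uv = trans (sym (+-identityʳ _))
    (trans (cong (λ c → edgeCount (addEdge G u v u≢v) + χ c) (sym (¬-not ¬uv)))
           (edgeCount-setAdj true))

-- Destroying triangles

module _ {n : ℕ} {G G′ : Graph n} where

  Triangle-lift : (∀ {i j} → Adj G′ i j → OnTriangle G′ i → OnTriangle G′ j → Adj G i j) →
    ∀ {p q r} → Triangle G′ p q r → Triangle G p q r
  Triangle-lift keep {p} {q} {r} pqr@(pq , qr , pr) =
    keep pq onp onq , keep qr onq onr , keep pr onp onr
    where
    onp : OnTriangle G′ p
    onp = q , r , pqr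
    onq : OnTriangle G′ q
    onq = r , p , Triangle-rotate G′ pqr
    onr : OnTriangle G′ r
    onr = p , q , Triangle-rotate G′ (Triangle-rotate G′ pqr)

  TrianglesIsolated-lift : (∀ {i j} → Adj G′ i j → OnTriangle G′ i → Adj G i j) →
    TrianglesIsolated G → TrianglesIsolated G′
  TrianglesIsolated-lift keep isolated pqr pt =
    isolated (Triangle-lift (λ ij oni _ → keep ij oni) pqr) (keep pt (_ , _ , pqr))

  off-triangle-of-isolated : TrianglesIsolated G →
    (∀ {p q r} → Triangle G′ p q r → Triangle G p q r) →
    ∀ {x y z} → Triangle G x y z → ¬ OnTriangle G′ y → ¬ OnTriangle G′ x
  off-triangle-of-isolated isolated lift xyz y-off (p , q , xpq@(_ , pq , _))
    with isolated xyz (proj₁ (lift xpq)) | isolated xyz (proj₂ (proj₂ (lift xpq)))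
  ... | inj₁ refl | _         = y-off (q , _ , Triangle-rotate G′ xpq)
  ... | inj₂ refl | inj₁ refl = y-off (_ , p , Triangle-rotate G′ (Triangle-rotate G′ xpq))
  ... | inj₂ refl | inj₂ refl = Adj⇒≢ G′ pq refl

  SquareFree-lift : ∀ {u v} → (∀ {i j} → Adj G′ i j → IsPair u v i j ⊎ Adj G i j) →
    (∀ {s t} → ¬ Square G′ u v s t) → SquareFree G → SquareFree G′
  SquareFree-lift new no-square square-free sq = square-free (record
    { xy = first-edge sq
    ; yz = first-edge (Square-rotate G′ sq)
    ; zt = first-edge (Square-rotate G′ (Square-rotate G′ sq))
    ; tx = first-edge (Square-rotate G′ (Square-rotate G′ (Square-rotate G′ sq)))
    ; x≢z = Square.x≢z sq
    ; y≢t = Square.y≢t sq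
    })
    where
    first-edge : ∀ {a b c d} → Square G′ a b c d → Adj G a b
    first-edge sq with new (Square.xy sq)
    ... | inj₁ (inj₁ (refl , refl)) = ⊥-elim (no-square sq)
    ... | inj₁ (inj₂ (refl , refl)) = ⊥-elim (no-square (Square-reverse G′ sq))
    ... | inj₂ ab = ab

-- As x and y have no neighbours off the triangle and z ≁ w, the new edge xw lies on no
-- triangle and no 4-cycle.
module Reattach {n : ℕ} {G : Graph n} {x y z w : Fin n}
  (xyz : Triangle G x y z)
  (x-nbrs : ∀ {t} → Adj G x t → t ≡ y ⊎ t ≡ z)
  (y-nbrs : ∀ {t} → Adj G y t → t ≡ x ⊎ t ≡ z)
  (w≢x : w ≢ x) (w≢y : w ≢ y) (w≢z : w ≢ z) (z≁w : ¬ Adj G z w)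
  where

  private
    x≢z : x ≢ z
    x≢z = Adj⇒≢ G (proj₂ (proj₂ xyz))
    x≢w : x ≢ w
    x≢w = w≢x ∘ sym
    G₀ : Graph n
    G₀ = removeEdge G x z x≢z

  graph : Graph n
  graph = addEdge G₀ x w x≢w

  Adj-graph : ∀ {i j} → Adj graph i j → IsPair x w i j ⊎ Adj G i j
  Adj-graph ij with Adj-addEdge ij
  ... | inj₁ p   = inj₁ p
  ... | inj₂ ij₀ = inj₂ (proj₂ (Adj-removeEdge ij₀))

  Adj-graph-away : ∀ {i j} → Adj graph i j → i ≢ x → i ≢ w → Adj G i j
  Adj-graph-away ij i≢x i≢w with Adj-graph ij
  ... | inj₁ (inj₁ (i≡x , _)) = ⊥-elim (i≢x i≡x)
  ... | inj₁ (inj₂ (i≡w , _)) = ⊥-elim (i≢w i≡w)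
  ... | inj₂ ij′ = ij′

  x-nbrs′ : ∀ {t} → Adj graph x t → t ≡ y ⊎ t ≡ w
  x-nbrs′ xt with Adj-addEdge xt
  ... | inj₁ (inj₁ (_ , t≡w)) = inj₂ t≡w
  ... | inj₁ (inj₂ (x≡w , _)) = ⊥-elim (x≢w x≡w)
  ... | inj₂ xt₀ with Adj-removeEdge xt₀
  ...   | ¬xz , xt′ with x-nbrs xt′
  ...     | inj₁ t≡y = inj₁ t≡y
  ...     | inj₂ t≡z = ⊥-elim (¬xz (inj₁ (refl , t≡z)))

  y-nbrs′ : ∀ {t} → Adj graph y t → t ≡ x ⊎ t ≡ z
  y-nbrs′ yt = y-nbrs (Adj-graph-away yt (Adj⇒≢ G (Adj-sym G (proj₁ xyz))) (w≢y ∘ sym))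

  w-nbrs′ : ∀ {t} → Adj graph w t → t ≡ x ⊎ Adj G w t
  w-nbrs′ wt with Adj-graph wt
  ... | inj₁ (inj₁ (w≡x , _)) = ⊥-elim (w≢x w≡x)
  ... | inj₁ (inj₂ (_ , t≡x)) = inj₁ t≡x
  ... | inj₂ wt′ = inj₂ wt′

  x-off : ¬ OnTriangle graph x
  x-off = off-triangle-of-two-neighbours graph x-nbrs′ λ yw → [ w≢x , w≢z ]′ (y-nbrs′ yw)

  Triangle-graph : ∀ {p q r} → Triangle graph p q r → Triangle G p q r
  Triangle-graph = Triangle-lift {G = G} {G′ = graph} keep
    where
    keep : ∀ {i j} → Adj graph i j → OnTriangle graph i → OnTriangle graph j → Adj G i j
    keep {i} {j} ij oni onj with Adj-graph {i} {j} ij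
    ... | inj₁ (inj₁ (refl , _)) = ⊥-elim (x-off oni)
    ... | inj₁ (inj₂ (_ , refl)) = ⊥-elim (x-off onj)
    ... | inj₂ ij′ = ij′

  SquareFree-graph : SquareFree G → SquareFree graph
  SquareFree-graph = SquareFree-lift {G = G} {G′ = graph} Adj-graph no-square
    where
    no-square : ∀ {s t} → ¬ Square graph x w s t
    no-square sq with x-nbrs′ (Adj-sym graph (Square.tx sq))
    ... | inj₂ t≡w = Square.y≢t sq (sym t≡w)
    ... | inj₁ refl with y-nbrs′ (Adj-sym graph (Square.zt sq))
    ...   | inj₁ s≡x = Square.x≢z sq (sym s≡x)
    ...   | inj₂ refl = z≁w (Adj-graph-away (Adj-sym graph (Square.yz sq)) (x≢z ∘ sym) (w≢z ∘ sym))

  edgeCount-graph : PairsListedOnce n → edgeCount graph ≡ edgeCount G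
  edgeCount-graph once =
    trans (edgeCount-addEdge once x≁w) (edgeCount-removeEdge once (proj₂ (proj₂ xyz)))
    where
    x≁w : ¬ Adj G₀ x w
    x≁w xw = [ w≢y , w≢z ]′ (x-nbrs (proj₂ (Adj-removeEdge xw)))

record TriangleRemoval {n : ℕ} (G : Graph n) (a : Fin n) : Set where
  field
    graph           : Graph n
    admissible      : Admissible graph
    a-off           : ¬ OnTriangle graph a
    fewer-triangles : ∀ {v} → OnTriangle graph v → OnTriangle G v
    same-size       : edgeCount graph ≡ edgeCount G

module RemoveTriangle {n : ℕ} (once : PairsListedOnce n) {G : Graph n} (admissible : Admissible G)
  {a b c w : Fin n} (abc : Triangle G a b c) (w≢a : w ≢ a) (w≢b : w ≢ b) (w≢c : w ≢ c) where

  private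
    isolated : TrianglesIsolated G
    isolated = proj₂ admissible

    cab : Triangle G c a b
    cab = Triangle-rotate G (Triangle-rotate G abc)

    module M₁ = Reattach {G = G} abc (isolated abc) (swap ∘ isolated (Triangle-rotate G abc))
                  w≢a w≢b w≢c ([ w≢a , w≢b ]′ ∘ isolated cab)

    G₁ : Graph n
    G₁ = M₁.graph

  pendant : ¬ OnTriangle G₁ w → TriangleRemoval G a
  pendant w-off = record
    { graph           = G₁
    ; admissible      = M₁.SquareFree-graph (proj₁ admissible) ,
                        TrianglesIsolated-lift {G = G} {G′ = G₁} keep isolated
    ; a-off           = M₁.x-off
    ; fewer-triangles = λ (_ , _ , t) → _ , _ , M₁.Triangle-graph t
    ; same-size       = M₁.edgeCount-graph once
    }
    where
    keep : ∀ {i j} → Adj G₁ i j → OnTriangle G₁ i → Adj G i j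
    keep ij oni = M₁.Adj-graph-away ij (OnTriangle⇒≢ G₁ M₁.x-off oni) (OnTriangle⇒≢ G₁ w-off oni)

  hexagon : ∀ {e f} → Triangle G₁ w e f → TriangleRemoval G a
  hexagon {e} {f} wef₁ = record
    { graph           = G₂
    ; admissible      = M₂.SquareFree-graph (M₁.SquareFree-graph (proj₁ admissible)) ,
                        TrianglesIsolated-lift {G = G} {G′ = G₂} keep isolated
    ; a-off           = a-off
    ; fewer-triangles = λ (_ , _ , t) → _ , _ , Triangle-G₂ t
    ; same-size       = trans (M₂.edgeCount-graph once) (M₁.edgeCount-graph once)
    }
    where
    wef : Triangle G w e f
    wef = M₁.Triangle-graph wef₁

    w≢e : w ≢ e
    w≢e = Adj⇒≢ G (proj₁ wef)
    w≢f : w ≢ f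
    w≢f = Adj⇒≢ G (proj₂ (proj₂ wef))

    f-nbrs : ∀ {t} → Adj G₁ f t → t ≡ e ⊎ t ≡ w
    f-nbrs ft = swap (isolated (Triangle-rotate G (Triangle-rotate G wef))
      (M₁.Adj-graph-away ft (isolated-apart G isolated abc (proj₂ (proj₂ wef)) w≢b w≢c)
                            (w≢f ∘ sym)))

    e-nbrs : ∀ {t} → Adj G₁ e t → t ≡ f ⊎ t ≡ w
    e-nbrs et = isolated (Triangle-rotate G wef)
      (M₁.Adj-graph-away et (isolated-apart G isolated abc (proj₁ wef) w≢b w≢c) (w≢e ∘ sym))

    w≁c : ¬ Adj G₁ w c
    w≁c wc with M₁.w-nbrs′ wc
    ... | inj₁ c≡a = Adj⇒≢ G (proj₂ (proj₂ abc)) (sym c≡a)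
    ... | inj₂ wc′ = isolated-apart G isolated cab wc′ w≢a w≢b refl

    module M₂ = Reattach {G = G₁}
      (Triangle-swap G₁ (Triangle-rotate G₁ (Triangle-rotate G₁ wef₁))) f-nbrs e-nbrs
      (isolated-apart G isolated cab (proj₂ (proj₂ wef)) w≢a w≢b ∘ sym)
      (isolated-apart G isolated cab (proj₁ wef) w≢a w≢b ∘ sym)
      (w≢c ∘ sym) w≁c

    G₂ : Graph n
    G₂ = M₂.graph

    Triangle-G₂ : ∀ {p q r} → Triangle G₂ p q r → Triangle G p q r
    Triangle-G₂ t = M₁.Triangle-graph (M₂.Triangle-graph t)

    a-off : ¬ OnTriangle G₂ a
    a-off (_ , _ , t) = M₁.x-off (_ , _ , M₂.Triangle-graph t)

    c-off : ¬ OnTriangle G₂ c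
    c-off = off-triangle-of-isolated {G = G} {G′ = G₂} isolated Triangle-G₂ cab a-off

    w-off : ¬ OnTriangle G₂ w
    w-off = off-triangle-of-isolated {G = G} {G′ = G₂} isolated Triangle-G₂
              (Triangle-swap G wef) M₂.x-off

    keep : ∀ {i j} → Adj G₂ i j → OnTriangle G₂ i → Adj G i j
    keep ij oni@(_ , _ , t) = M₁.Adj-graph-away
      (M₂.Adj-graph-away ij (OnTriangle⇒≢ G₂ M₂.x-off oni) (OnTriangle⇒≢ G₂ c-off oni))
      (OnTriangle⇒≢ G₁ M₁.x-off (_ , _ , M₂.Triangle-graph t)) (OnTriangle⇒≢ G₂ w-off oni)

  result : TriangleRemoval G a
  result with OnTriangle? G₁ w
  ... | yes (_ , _ , wef₁) = hexagon wef₁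
  ... | no w-off           = pendant w-off

fresh : ∀ {n} (xs : List (Fin n)) → length xs < n → ∃ λ w → w ∉ xs
fresh {n} xs |xs|<n = ¬∀⟶∃¬ n (_∈ xs) (_∈? xs) not-all
  where
  open import Data.List.Membership.DecPropositional _≟ᶠ_ using (_∈?_)
  not-all : ¬ (∀ w → w ∈ xs)
  not-all all-in with pigeonhole |xs|<n (λ w → index (all-in w))
  ... | i , j , i<j , same =
    <-irrefl (index-injective (setoid (Fin n)) (all-in i) (all-in j) same) i<j

removeTriangleAt : ∀ {n} → PairsListedOnce n → 4 ≤ n → {G : Graph n} → Admissible G →
  ∀ {a b c} → Triangle G a b c → TriangleRemoval G a
removeTriangleAt once 4≤n admissible {a} {b} {c} abc with fresh (a ∷ b ∷ c ∷ []) 4≤n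
... | w , w∉ = RemoveTriangle.result once admissible abc
                 (w∉ ∘ here) (w∉ ∘ there ∘ here) (w∉ ∘ there ∘ there ∘ here)

∉-∷-elim : ∀ {n} {P : Fin n → Set} {v vs} → (∀ {u} → u ∉ v ∷ vs → P u) → P v → ∀ {u} → u ∉ vs → P u
∉-∷-elim {v = v} outside Pv {u} u∉vs with u ≟ᶠ v
... | yes refl = Pv
... | no u≢v   = outside λ { (here u≡v) → u≢v u≡v ; (there u∈vs) → u∉vs u∈vs }

removeTriangles : ∀ {n} → PairsListedOnce n → 4 ≤ n → (vs : List (Fin n)) (G : Graph n) →
  Admissible G → (∀ {v} → v ∉ vs → ¬ OnTriangle G v) →
  Σ[ G′ ∈ Graph n ] Admissible G′ × TriangleFree G′ × edgeCount G′ ≡ edgeCount G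
removeTriangles once 4≤n [] G admissible off = G , admissible , (λ v → off λ ()) , refl
removeTriangles {n} once 4≤n (v ∷ vs) G admissible off with OnTriangle? G v
... | no v-off = removeTriangles once 4≤n vs G admissible (∉-∷-elim off v-off)
... | yes (_ , _ , vyz) = continue (removeTriangleAt once 4≤n admissible vyz)
  where
  continue : TriangleRemoval G v →
    Σ[ G′ ∈ Graph n ] Admissible G′ × TriangleFree G′ × edgeCount G′ ≡ edgeCount G
  continue R with removeTriangles once 4≤n vs R.graph R.admissible
                    (∉-∷-elim (λ v∉ on → off v∉ (R.fewer-triangles on)) R.a-off)
    where module R = TriangleRemoval R
  ... | G′ , admissible′ , triangle-free , size =
    G′ , admissible′ , triangle-free , trans size (TriangleRemoval.same-size R)

K₁₃+eC₄-free⇒C₃C₄-free-of-equal-size : ∀ {n} → PairsListedOnce n → 4 ≤ n → (G : Graph n) →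
  Free (K₁₃+e ∷ C₄ ∷ []) G → Σ[ G′ ∈ Graph n ] Free (C₃ ∷ C₄ ∷ []) G′ × edgeCount G′ ≡ edgeCount G
K₁₃+eC₄-free⇒C₃C₄-free-of-equal-size {n} once 4≤n G free
  with removeTriangles once 4≤n (allFin n) G (K₁₃+eC₄-free⇒admissible G free)
         (λ v∉ → ⊥-elim (v∉ (∈-allFin _)))
... | G′ , (square-free , _) , triangle-free , count =
  G′ , triangle-free⇒C₃C₄-free G′ square-free triangle-free , count

IsExt-⇔ : ∀ {ℋ ℋ′ n m} → (∀ (G : Graph n) → Free ℋ′ G → Free ℋ G) →
  (∀ (G : Graph n) → Free ℋ G → Σ[ G′ ∈ Graph n ] Free ℋ′ G′ × edgeCount G′ ≡ edgeCount G) →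
  IsExt ℋ n m ⇔ IsExt ℋ′ n m
IsExt-⇔ {ℋ} {ℋ′} {n} {m} weaken reduce = mk⇔ to from
  where
  to : IsExt ℋ n m → IsExt ℋ′ n m
  to ((G , free , size) , bound) =
    let (G′ , free′ , size′) = reduce G free
    in (G′ , free′ , trans size′ size) , λ H free′-H → bound H (weaken H free′-H)

  from : IsExt ℋ′ n m → IsExt ℋ n m
  from ((G , free′ , size) , bound′) =
    (G , weaken G free′ , size) , λ H free-H →
      let (H′ , free′-H′ , size′) = reduce H free-H in subst (_≤ m) size′ (bound′ H′ free′-H′)

corollary5 : ∀ (n : ℕ) → 4 ≤ n → n ≤ 10 → ∀ (m : ℕ) →
    IsExt (K₁₃+e ∷ C₄ ∷ []) n m ⇔ IsExt (C₃ ∷ C₄ ∷ []) n m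
corollary5 n 4≤n n≤10 m =
  IsExt-⇔ C₃C₄-free⇒K₁₃+eC₄-free (K₁₃+eC₄-free⇒C₃C₄-free-of-equal-size (pairsListedOnce n≤10) 4≤n)
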